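{- For every finite simple graph $G$ and every integer $k\ge 2$, the graph $\mathbf{I}(M(G,k))$ is isomorphic to $G$.
   Context: Construction of $M(G,1)$: choose points $p_v$ ($v\in V(G)$) in $\mathbb{R}^2$ in general position; for each edge $uv\in E(G)$ add a point $p_{uv}$ on the line through $p_u$ and $p_v$ not lying on any line through another pair of the points. $M(G,1)$ is the matroid on this point set whose circuits are all 4-element sets and all triples $\{p_u,p_v,p_{uv}\}$ with $uv\in E(G)$ (equivalently, bases are non-collinear triples). $M(G,k)$ is obtained from $M(G,1)$ by adding, for each $v\in V(G)$, $k-1$ new elements parallel to $p_v$. A matroid is viewed as a structure in which $I_j(x_1,\dots,x_j)$ holds iff $x_1,\dots,x_j$ are pairwise distinct and $\{x_1,\dots,x_j\}$ is independent. For a matroid $M$, $\mathbf{I}(M)$ is the graph defined as follows: let $\theta_0(x)\equiv\exists y\,(x\ne y\wedge\neg I_2(x,y))$, $\theta_E(x,y)\equiv\neg I_2(x,y)$, and $\theta_1(x,y)\equiv I_2(x,y)\wedge\exists z\,(I_2(x,z)\wedge I_2(y,z)\wedge\neg I_3(x,y,z))$. The vertices of $\mathbf{I}(M)$ are the $\theta_E$-equivalence classes $[x]$ of elements $x$ of $M$ satisfying $\theta_0(x)$, and $[x],[y]$ are adjacent iff $M\models\theta_1(x,y)$ (this is independent of the representatives in $M(G,k)$). -}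

module Defs where

open import Data.Nat using (ℕ; _≤_)
open import Data.Fin using (Fin; zero; suc) renaming (_<_ to _<ᶠ_)
open import Data.Bool using (Bool; true; false)
open import Data.List using (List; []; _∷_; length; map)
open import Data.List.Membership.Propositional using (_∈_)
open import Data.List.Relation.Unary.Unique.Propositional using (Unique)
open import Data.Product using (Σ; _×_; ∃; _,_; proj₁)
open import Relation.Binary.PropositionalEquality using (_≡_; _≢_)
open import Relation.Nullary using (¬_)

record SimpleGraph (n : ℕ) : Set where
  field
    adj    : Fin n → Fin n → Bool
    sym    : ∀ u v → adj u v ≡ adj v u
    irrefl : ∀ v → adj v v ≡ false

open SimpleGraph public

Adj : ∀ {n} → SimpleGraph n → Fin n → Fin n → Set
Adj G u v = adj G u v ≡ true

-- A matroid viewed as a structure: carrier + independence of finite sets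
-- (finite sets given as lists; only duplicate-free lists are meaningful).

record IndepStructure : Set₁ where
  field
    Carrier : Set
    Indep   : List Carrier → Set

module _ (M : IndepStructure) where
  open IndepStructure M

  I₂ : Carrier → Carrier → Set
  I₂ x y = x ≢ y × Indep (x ∷ y ∷ [])

  I₃ : Carrier → Carrier → Carrier → Set
  I₃ x y z = (x ≢ y × x ≢ z × y ≢ z) × Indep (x ∷ y ∷ z ∷ [])

  θ₀ : Carrier → Set
  θ₀ x = ∃ λ y → x ≢ y × ¬ I₂ x y

  θE : Carrier → Carrier → Set
  θE x y = ¬ I₂ x y

  θ₁ : Carrier → Carrier → Set
  θ₁ x y = I₂ x y × ∃ λ z → I₂ x z × I₂ y z × ¬ I₃ x y z

  -- Vertices of I(M): elements satisfying θ₀, up to θE.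
  IVertex : Set
  IVertex = Σ Carrier θ₀

  -- I(M) is isomorphic to G: a map from representatives to V(G) that
  -- is well defined and injective on θE-classes, surjective, and
  -- preserves and reflects adjacency.
  IGraphIso : ∀ {n} → SimpleGraph n → Set
  IGraphIso {n} G = Σ (IVertex → Fin n) λ f →
      (∀ x y → θE (proj₁ x) (proj₁ y) → f x ≡ f y)
    × (∀ x y → f x ≡ f y → θE (proj₁ x) (proj₁ y))
    × (∀ v → ∃ λ x → f x ≡ v)
    × (∀ x y → (θ₁ (proj₁ x) (proj₁ y) → Adj G (f x) (f y))
             × (Adj G (f x) (f y) → θ₁ (proj₁ x) (proj₁ y)))

data Pt {n : ℕ} (G : SimpleGraph n) : Set where
  pv : Fin n → Pt G
  pe : (u v : Fin n) → u <ᶠ v → Adj G u v → Pt G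

-- Independent sets of M(G,1): contain no circuit, i.e. at most 3
-- elements and not containing any triple {p_u, p_v, p_uv}.
Indep₁ : ∀ {n} (G : SimpleGraph n) → List (Pt G) → Set
Indep₁ G T = Unique T × length T ≤ 3
  × (∀ u v (u<v : u <ᶠ v) (a : Adj G u v) →
       ¬ (pv u ∈ T × pv v ∈ T × pe u v u<v a ∈ T))

-- Elements of M(G,k): k copies (pairwise parallel) of each p_v,
-- copy 0 being p_v itself, and the points p_uv.
data Elt {n : ℕ} (G : SimpleGraph n) (k : ℕ) : Set where
  vx : Fin n → Fin k → Elt G k
  ed : (u v : Fin n) → u <ᶠ v → Adj G u v → Elt G k

rep : ∀ {n} {G : SimpleGraph n} {k} → Elt G k → Pt G
rep (vx v _)        = pv v
rep (ed u v u<v a)  = pe u v u<v a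

-- Parallel extension: independent iff no two distinct elements are
-- parallel and the image in M(G,1) is independent.
M : ∀ {n} (G : SimpleGraph n) (k : ℕ) → IndepStructure
M G k = record
  { Carrier = Elt G k
  ; Indep   = λ S → Unique S × Indep₁ G (map rep S)
  }

module Submission where

open import Defs hiding (sym)
open import Data.Nat using (ℕ; _≤_; suc; s≤s; z≤n)
open import Data.Fin using (Fin; zero; suc) renaming (_<_ to _<ᶠ_)
open import Data.Fin.Properties using (<-cmp; <-irrefl; _≟_)
open import Data.Bool using (true; false)
open import Data.List using (List; []; _∷_)
open import Data.List.Relation.Unary.Any using (here; there)
open import Data.List.Relation.Unary.All using ([]; _∷_)
open import Data.List.Relation.Unary.AllPairs using ([]; _∷_)
open import Data.List.Membership.Propositional using (_∈_)
open import Data.Product using (_×_; _,_; proj₁)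
open import Data.Empty using (⊥; ⊥-elim)
open import Function using (case_of_)
open import Relation.Binary.PropositionalEquality using (_≡_; _≢_; refl; sym; trans)
open import Relation.Binary.Definitions using (tri<; tri≈; tri>)
open import Relation.Nullary using (¬_; yes; no)

-- In M(G,k) every pair of non-parallel elements is independent, and the
-- points p_uv are parallel to nothing; so the elements satisfying θ₀ are
-- exactly the copies of the p_v (k ≥ 2 provides a second copy), θE
-- identifies copies of the same p_v, and a third element z spoils the
-- independence of {p_u, p_v, z} exactly when z = p_uv, i.e. when uv ∈ E(G).

module _ {n : ℕ} (G : SimpleGraph n) where

  TriangleFree : List (Pt G) → Set
  TriangleFree T = ∀ u v (u<v : u <ᶠ v) (a : Adj G u v) →
    ¬ (pv u ∈ T × pv v ∈ T × pe u v u<v a ∈ T)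

  adj⇒≢ : ∀ {u v} → Adj G u v → u ≢ v
  adj⇒≢ {u} a refl with () ← trans (sym a) (irrefl G u)

  pv≢ : ∀ {u v} → u ≢ v → pv {G = G} u ≢ pv v
  pv≢ u≢v refl = u≢v refl

  pair-triangleFree : ∀ r s → TriangleFree (r ∷ s ∷ [])
  pair-triangleFree _ _ u v u<v a (here refl , here refl , _)                 = <-irrefl refl u<v
  pair-triangleFree _ _ u v u<v a (there (here refl) , there (here refl) , _) = <-irrefl refl u<v
  pair-triangleFree _ _ u v u<v a (here refl , there (here refl) , here ())
  pair-triangleFree _ _ u v u<v a (here refl , there (here refl) , there (here ()))
  pair-triangleFree _ _ u v u<v a (there (here refl) , here refl , here ())
  pair-triangleFree _ _ u v u<v a (there (here refl) , here refl , there (here ()))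
  pair-triangleFree _ _ u v u<v a (_ , _ , there (there ()))
  pair-triangleFree _ _ u v u<v a (_ , there (there ()) , _)
  pair-triangleFree _ _ u v u<v a (there (there ()) , _ , _)

  -- Only the third point can be some p_ab, and then {a, b} = {u, v}.
  nonEdge-triangleFree : ∀ {u v} → ¬ Adj G u v → ∀ t → TriangleFree (pv u ∷ pv v ∷ t ∷ [])
  nonEdge-triangleFree ¬uv t a b a<b ab (_ , _ , here ())
  nonEdge-triangleFree ¬uv t a b a<b ab (_ , _ , there (here ()))
  nonEdge-triangleFree ¬uv t a b a<b ab (_ , _ , there (there (there ())))
  nonEdge-triangleFree ¬uv .(pe a b a<b ab) a b a<b ab (a∈ , b∈ , there (there (here refl))) =
    endpoints a∈ b∈
    where
    T : List (Pt G)
    T = pv _ ∷ pv _ ∷ pe a b a<b ab ∷ []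
    endpoints : pv a ∈ T → pv b ∈ T → ⊥
    endpoints (here refl)         (here refl)         = <-irrefl refl a<b
    endpoints (there (here refl)) (there (here refl)) = <-irrefl refl a<b
    endpoints (here refl)         (there (here refl)) = ¬uv ab
    endpoints (there (here refl)) (here refl)         = ¬uv (trans (SimpleGraph.sym G b a) ab)
    endpoints _ (there (there (here ())))
    endpoints _ (there (there (there ())))
    endpoints (there (there (here ()))) _
    endpoints (there (there (there ()))) _

  module _ (k : ℕ) where

    private
      Mk = M G k

    rep≢⇒I₂ : ∀ {x y} → rep x ≢ rep y → I₂ Mk x y
    rep≢⇒I₂ {x} {y} r≢ =
      x≢y , ((x≢y ∷ []) ∷ [] ∷ []) , ((r≢ ∷ []) ∷ [] ∷ []) , s≤s (s≤s z≤n) ,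
      pair-triangleFree (rep x) (rep y)
      where x≢y = λ { refl → r≢ refl }

    I₂⇒rep≢ : ∀ {x y} → I₂ Mk x y → rep x ≢ rep y
    I₂⇒rep≢ (_ , _ , ((r≢ ∷ []) ∷ _) , _) = r≢

    rep≢⇒I₃ : ∀ {x y z} → rep x ≢ rep y → rep x ≢ rep z → rep y ≢ rep z →
              TriangleFree (rep x ∷ rep y ∷ rep z ∷ []) → I₃ Mk x y z
    rep≢⇒I₃ rxy rxz ryz free =
      (x≢y , x≢z , y≢z) , ((x≢y ∷ x≢z ∷ []) ∷ (y≢z ∷ []) ∷ [] ∷ []) ,
      ((rxy ∷ rxz ∷ []) ∷ (ryz ∷ []) ∷ [] ∷ []) , s≤s (s≤s (s≤s z≤n)) , free
      where
      x≢y = λ { refl → rxy refl }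
      x≢z = λ { refl → rxz refl }
      y≢z = λ { refl → ryz refl }

    I₃⇒triangleFree : ∀ {x y z} → I₃ Mk x y z → TriangleFree (rep x ∷ rep y ∷ rep z ∷ [])
    I₃⇒triangleFree (_ , _ , _ , _ , free) = free

    rep≡pe : ∀ (y : Elt G k) {u v u<v a} → rep y ≡ pe u v u<v a → y ≡ ed u v u<v a
    rep≡pe (ed _ _ _ _) refl = refl

    ed-¬θ₀ : ∀ {u v} (u<v : u <ᶠ v) (a : Adj G u v) → ¬ θ₀ Mk (ed u v u<v a)
    ed-¬θ₀ u<v a (y , x≢y , ¬I₂) = ¬I₂ (rep≢⇒I₂ λ eq → x≢y (sym (rep≡pe y (sym eq))))

    vx-θ₀ : ∀ v {i j} → i ≢ j → θ₀ Mk (vx v i)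
    vx-θ₀ v {j = j} i≢j = vx v j , (λ { refl → i≢j refl }) , λ I → I₂⇒rep≢ I refl

    data VertexView : IVertex Mk → Set where
      copy : ∀ v i h → VertexView (vx v i , h)

    vertexView : ∀ x → VertexView x
    vertexView (vx v i , h)        = copy v i h
    vertexView (ed u v u<v a , h) = ⊥-elim (ed-¬θ₀ u<v a h)

    vertexOf : IVertex Mk → Fin n
    vertexOf x with vertexView x
    ... | copy v _ _ = v

    vx-θE⇒≡ : ∀ {u i v j} → θE Mk (vx u i) (vx v j) → u ≡ v
    vx-θE⇒≡ {u} {v = v} ¬I₂ with u ≟ v
    ... | yes u≡v = u≡v
    ... | no u≢v  = ⊥-elim (¬I₂ (rep≢⇒I₂ (pv≢ u≢v)))

    ≡⇒vx-θE : ∀ {u i j} → θE Mk (vx u i) (vx u j)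
    ≡⇒vx-θE I = I₂⇒rep≢ I refl

    vx-θ₁⇒Adj : ∀ {u i v j} → θ₁ Mk (vx u i) (vx v j) → Adj G u v
    vx-θ₁⇒Adj {u} {v = v} (Ixy , z , Ixz , Iyz , ¬I₃) with adj G u v in uv
    ... | true  = refl
    ... | false = ⊥-elim (¬I₃ (rep≢⇒I₃ (I₂⇒rep≢ Ixy) (I₂⇒rep≢ Ixz) (I₂⇒rep≢ Iyz)
                    (nonEdge-triangleFree (λ uv-true → case trans (sym uv-true) uv of λ ()) (rep z))))

    -- The witness z is p_uv, with the edge oriented as Pt requires.
    Adj⇒vx-θ₁ : ∀ {u i v j} → Adj G u v → θ₁ Mk (vx u i) (vx v j)
    Adj⇒vx-θ₁ {u} {v = v} uv with <-cmp u v
    ... | tri≈ _ u≡v _ = ⊥-elim (adj⇒≢ uv u≡v)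
    ... | tri< u<v _ _ = rep≢⇒I₂ (pv≢ (adj⇒≢ uv)) , ed u v u<v uv ,
          rep≢⇒I₂ (λ ()) , rep≢⇒I₂ (λ ()) ,
          λ I → I₃⇒triangleFree I u v u<v uv
                  (here refl , there (here refl) , there (there (here refl)))
    ... | tri> _ _ v<u = rep≢⇒I₂ (pv≢ (adj⇒≢ uv)) , ed v u v<u vu ,
          rep≢⇒I₂ (λ ()) , rep≢⇒I₂ (λ ()) ,
          λ I → I₃⇒triangleFree I v u v<u vu
                  (there (here refl) , here refl , there (there (here refl)))
      where vu = trans (SimpleGraph.sym G v u) uv

    IGraphIso-M : ∀ {i j : Fin k} → i ≢ j → IGraphIso Mk G
    IGraphIso-M i≢j = vertexOf , θE⇒same , same⇒θE , (λ v → (vx v _ , vx-θ₀ v i≢j) , refl) , θ₁⇔Adj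
      where
      θE⇒same : ∀ x y → θE Mk (proj₁ x) (proj₁ y) → vertexOf x ≡ vertexOf y
      θE⇒same x y with vertexView x | vertexView y
      ... | copy _ _ _ | copy _ _ _ = vx-θE⇒≡

      same⇒θE : ∀ x y → vertexOf x ≡ vertexOf y → θE Mk (proj₁ x) (proj₁ y)
      same⇒θE x y with vertexView x | vertexView y
      ... | copy _ _ _ | copy _ _ _ = λ { refl → ≡⇒vx-θE }

      θ₁⇔Adj : ∀ x y → (θ₁ Mk (proj₁ x) (proj₁ y) → Adj G (vertexOf x) (vertexOf y))
                     × (Adj G (vertexOf x) (vertexOf y) → θ₁ Mk (proj₁ x) (proj₁ y))
      θ₁⇔Adj x y with vertexView x | vertexView y
      ... | copy _ _ _ | copy _ _ _ = vx-θ₁⇒Adj , Adj⇒vx-θ₁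

lemma26 : ∀ {n : ℕ} (G : SimpleGraph n) (k : ℕ) → 2 ≤ k → IGraphIso (M G k) G
lemma26 G (suc (suc m)) (s≤s (s≤s z≤n)) = IGraphIso-M G (suc (suc m)) {zero} {suc zero} λ ()
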